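{- Let $p$ be a prime, $1\le m<p$, and $k\ge1$. For every $n\ge1$ the following holds in $Z_{p,n}$: \[\frac{1}{[p-m]^k}=\Big(-(q^p)^{ -1}\frac{q^m}{[m]}\Big)^k\sum_{l=0}^{n-1}\binom{k+l-1}{l}\Big((q^p)^{ -1}[p]\frac{q^m}{[m]}\Big)^l.\]
   Context: $[n]=(1-q^n)/(1-q)$. $\mathbb{Z}_{(p)}$ is the ring of rationals whose denominator is prime to $p$, and $Z_{p,n}=\mathbb{Z}_{(p)}[q]/([p]^n)$. In $Z_{p,n}$ the elements $[j]$ for $1\le j<p$ are invertible, and $q^p=1-(1-q)[p]$ is invertible. -}

module Defs where

open import Data.Nat using (ℕ; zero; suc; _∸_)
open import Data.Nat.Divisibility using (_∣_)
open import Data.Rational using (ℚ; 0ℚ; 1ℚ; ↧ₙ_) renaming (_+_ to _+ℚ_; _*_ to _*ℚ_; -_ to -ℚ_)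
open import Data.List using (List; []; _∷_; map; replicate)
open import Data.List.Relation.Unary.All using (All)
open import Data.Product using (Σ; _×_)
open import Relation.Binary.PropositionalEquality using (_≡_)
open import Relation.Nullary using (¬_)

-- Polynomials in q with rational coefficients, as coefficient lists
-- (lowest degree first).
Poly : Set
Poly = List ℚ

coeff : Poly → ℕ → ℚ
coeff []       _       = 0ℚ
coeff (a ∷ f)  zero    = a
coeff (a ∷ f)  (suc i) = coeff f i

-- equality of polynomials (coefficientwise; trailing zeros irrelevant)
_≈P_ : Poly → Poly → Set
f ≈P g = ∀ i → coeff f i ≡ coeff g i

infixl 6 _+P_ _-P_
infixl 7 _*P_
infixr 8 _^P_

_+P_ : Poly → Poly → Poly
[]      +P g       = g
(a ∷ f) +P []      = a ∷ f
(a ∷ f) +P (b ∷ g) = (a +ℚ b) ∷ (f +P g)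

scaleP : ℚ → Poly → Poly
scaleP c f = map (c *ℚ_) f

-P_ : Poly → Poly
-P f = map -ℚ_ f

_-P_ : Poly → Poly → Poly
f -P g = f +P (-P g)

_*P_ : Poly → Poly → Poly
[]      *P g = []
(a ∷ f) *P g = scaleP a g +P (0ℚ ∷ (f *P g))

oneP : Poly
oneP = 1ℚ ∷ []

qP : Poly
qP = 0ℚ ∷ 1ℚ ∷ []

_^P_ : Poly → ℕ → Poly
f ^P zero  = oneP
f ^P suc n = f *P (f ^P n)

natP : ℕ → Poly
natP zero    = []
natP (suc n) = oneP +P natP n

-- q-integer [j] = 1 + q + ... + q^(j-1) = (1 - q^j)/(1 - q)
[_]q : ℕ → Poly
[ j ]q = replicate j 1ℚ

ΣP : ℕ → (ℕ → Poly) → Poly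
ΣP zero    f = []
ΣP (suc n) f = ΣP n f +P f n

InZ₍_₎ : ℕ → ℚ → Set
InZ₍ p ₎ x = ¬ (p ∣ (↧ₙ x))

IsZpPoly : ℕ → Poly → Set
IsZpPoly p f = All (InZ₍ p ₎) f

-- congruence in Z_{p,n} = Z_(p)[q]/([p]^n):  f - g ∈ [p]^n · Z_(p)[q]
Cong : ℕ → ℕ → Poly → Poly → Set
Cong p n f g = Σ Poly (λ h → IsZpPoly p h × ((f -P g) ≈P (([ p ]q ^P n) *P h)))

-- Put x = (q^p)⁻¹ [p] q^m [m]⁻¹ and u = -(q^p)⁻¹ q^m [m]⁻¹. Since [p] = [p-m] + q^(p-m) [m],
-- the product [p-m]·u is 1 - x up to the two inverse congruences, so the left-hand side is
-- congruent to (1 - x)^k Σ_{l<n} C(k+l-1,l) x^l. The truncated negative binomial series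
-- satisfies (1 - x)^k Σ_{l<n} C(k+l-1,l) x^l = 1 - x^n T(x) for an explicit T with integer
-- coefficients, and x^n is a multiple of [p]^n. Every quotient that occurs has coefficients
-- in Z_(p); closure of Z_(p) under + and · is where primality of p is used.
module Submission where

open import Algebra.Bundles using (CommutativeRing)
open import Data.Integer as ℤ using (ℤ)
import Data.Integer.Properties as ℤₚ
open import Data.List using ([]; _∷_)
open import Data.List.Relation.Unary.All using ([]; _∷_) renaming (map to All-map)
open import Data.List.Relation.Unary.All.Properties using (map⁺; replicate⁺)
open import Data.Maybe using (Maybe; just; nothing)
open import Data.Nat using (ℕ; zero; suc; _≤_; _<_; _+_; _*_; _∸_; nonTrivial⇒≢1)
import Data.Nat.Properties as ℕₚ
open import Data.Nat.Combinatorics using (_C_; k>n⇒nCk≡0; nCk+nC[k+1]≡[n+1]C[k+1])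
open import Data.Nat.Divisibility using (_∣_; divides; ∣-trans; ∣1⇒≡1)
open import Data.Nat.Primality using (Prime; euclidsLemma; prime⇒nonTrivial)
open import Data.Product using (_,_)
open import Data.Rational using (ℚ; 0ℚ; 1ℚ; ↧_; ↧ₙ_) renaming (_+_ to _+ℚ_; _*_ to _*ℚ_; -_ to -ℚ_)
import Data.Rational.Properties as ℚₚ
open import Data.Rational.Solver using (module +-*-Solver)
open import Data.Sum using (inj₁; inj₂)
open import Relation.Binary.Bundles using (Setoid)
open import Relation.Binary.PropositionalEquality
import Relation.Binary.Reasoning.Setoid
open import Relation.Nullary using (¬_; yes)
open import Tactic.RingSolver using (solve-∀)
open import Tactic.RingSolver.Core.AlmostCommutativeRing using (AlmostCommutativeRing; fromCommutativeRing)

open import Defs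

↧ₙ∣↧ₙ*↧ₙ : ∀ (x y z : ℚ) {g : ℤ} → ↧ z ℤ.* g ≡ ↧ x ℤ.* ↧ y → ↧ₙ z ∣ ↧ₙ x * ↧ₙ y
↧ₙ∣↧ₙ*↧ₙ x y z {g} eq = divides ℤ.∣ g ∣ (begin
  ↧ₙ x * ↧ₙ y         ≡⟨ ℤₚ.abs-* (↧ x) (↧ y) ⟨
  ℤ.∣ ↧ x ℤ.* ↧ y ∣   ≡⟨ cong ℤ.∣_∣ eq ⟨
  ℤ.∣ ↧ z ℤ.* g ∣     ≡⟨ ℤₚ.abs-* (↧ z) g ⟩
  ↧ₙ z * ℤ.∣ g ∣      ≡⟨ ℕₚ.*-comm (↧ₙ z) ℤ.∣ g ∣ ⟩
  ℤ.∣ g ∣ * ↧ₙ z      ∎)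
  where open ≡-Reasoning

module _ {p : ℕ} (p-prime : Prime p) where

  InZ-0 : InZ₍ p ₎ 0ℚ
  InZ-0 p∣1 = nonTrivial⇒≢1 {{prime⇒nonTrivial p-prime}} (∣1⇒≡1 p∣1)

  InZ-1 : InZ₍ p ₎ 1ℚ
  InZ-1 = InZ-0

  InZ-neg : ∀ {x} → InZ₍ p ₎ x → InZ₍ p ₎ (-ℚ x)
  InZ-neg {x} = subst (λ d → ¬ p ∣ d) (cong ℤ.∣_∣ (sym (ℚₚ.↧-neg x)))

  InZ-∣ : ∀ {x y z} → ↧ₙ z ∣ ↧ₙ x * ↧ₙ y → InZ₍ p ₎ x → InZ₍ p ₎ y → InZ₍ p ₎ z
  InZ-∣ {x} {y} z∣xy p∤x p∤y p∣z with euclidsLemma (↧ₙ x) (↧ₙ y) p-prime (∣-trans p∣z z∣xy)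
  ... | inj₁ p∣x = p∤x p∣x
  ... | inj₂ p∣y = p∤y p∣y

  InZ-+ : ∀ {x y} → InZ₍ p ₎ x → InZ₍ p ₎ y → InZ₍ p ₎ (x +ℚ y)
  InZ-+ {x} {y} = InZ-∣ {x} {y} {x +ℚ y} (↧ₙ∣↧ₙ*↧ₙ x y (x +ℚ y) (ℚₚ.↧-+ x y))

  InZ-* : ∀ {x y} → InZ₍ p ₎ x → InZ₍ p ₎ y → InZ₍ p ₎ (x *ℚ y)
  InZ-* {x} {y} = InZ-∣ {x} {y} {x *ℚ y} (↧ₙ∣↧ₙ*↧ₙ x y (x *ℚ y) (ℚₚ.↧-* x y))

-- A record wrapper, so that f and g can be inferred from a proof of f ≈ g.
infix 4 _≈_
record _≈_ (f g : Poly) : Set where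
  constructor coeffwise
  field coeff-≡ : f ≈P g
open _≈_

≈-refl : ∀ {f} → f ≈ f
≈-refl .coeff-≡ i = refl

≈-sym : ∀ {f g} → f ≈ g → g ≈ f
≈-sym e .coeff-≡ i = sym (e .coeff-≡ i)

≈-trans : ∀ {f g h} → f ≈ g → g ≈ h → f ≈ h
≈-trans e d .coeff-≡ i = trans (e .coeff-≡ i) (d .coeff-≡ i)

≡⇒≈ : ∀ {f g} → f ≡ g → f ≈ g
≡⇒≈ refl = ≈-refl

∷-cong : ∀ {a b f g} → a ≡ b → f ≈ g → a ∷ f ≈ b ∷ g
∷-cong refl e .coeff-≡ zero    = refl
∷-cong refl e .coeff-≡ (suc i) = e .coeff-≡ i

0∷[]≈[] : 0ℚ ∷ [] ≈ []
0∷[]≈[] .coeff-≡ zero    = refl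
0∷[]≈[] .coeff-≡ (suc i) = refl

coeff-+P : ∀ f g i → coeff (f +P g) i ≡ coeff f i +ℚ coeff g i
coeff-+P []      g       i       = sym (ℚₚ.+-identityˡ _)
coeff-+P (a ∷ f) []      i       = sym (ℚₚ.+-identityʳ _)
coeff-+P (a ∷ f) (b ∷ g) zero    = refl
coeff-+P (a ∷ f) (b ∷ g) (suc i) = coeff-+P f g i

coeff-scaleP : ∀ c f i → coeff (scaleP c f) i ≡ c *ℚ coeff f i
coeff-scaleP c []      i       = sym (ℚₚ.*-zeroʳ c)
coeff-scaleP c (a ∷ f) zero    = refl
coeff-scaleP c (a ∷ f) (suc i) = coeff-scaleP c f i

coeff--P : ∀ f i → coeff (-P f) i ≡ -ℚ coeff f i
coeff--P []      i       = refl
coeff--P (a ∷ f) zero    = refl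
coeff--P (a ∷ f) (suc i) = coeff--P f i

coeff-∷*P : ∀ a f g i → coeff ((a ∷ f) *P g) i ≡ a *ℚ coeff g i +ℚ coeff (0ℚ ∷ f *P g) i
coeff-∷*P a f g i =
  trans (coeff-+P (scaleP a g) (0ℚ ∷ f *P g) i) (cong (_+ℚ coeff (0ℚ ∷ f *P g) i) (coeff-scaleP a g i))

+P-cong : ∀ {f f′ g g′} → f ≈ f′ → g ≈ g′ → f +P g ≈ f′ +P g′
+P-cong {f} {f′} {g} {g′} e d .coeff-≡ i =
  trans (coeff-+P f g i) (trans (cong₂ _+ℚ_ (e .coeff-≡ i) (d .coeff-≡ i)) (sym (coeff-+P f′ g′ i)))

-P-cong : ∀ {f f′} → f ≈ f′ → -P f ≈ -P f′
-P-cong {f} {f′} e .coeff-≡ i =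
  trans (coeff--P f i) (trans (cong -ℚ_ (e .coeff-≡ i)) (sym (coeff--P f′ i)))

scaleP-cong : ∀ c {f f′} → f ≈ f′ → scaleP c f ≈ scaleP c f′
scaleP-cong c {f} {f′} e .coeff-≡ i =
  trans (coeff-scaleP c f i) (trans (cong (c *ℚ_) (e .coeff-≡ i)) (sym (coeff-scaleP c f′ i)))

*P-congˡ : ∀ f {g g′} → g ≈ g′ → f *P g ≈ f *P g′
*P-congˡ []      e = ≈-refl
*P-congˡ (a ∷ f) e = +P-cong (scaleP-cong a e) (∷-cong refl (*P-congˡ f e))

+P-assoc : ∀ f g h → (f +P g) +P h ≈ f +P (g +P h)
+P-assoc f g h .coeff-≡ i
  rewrite coeff-+P (f +P g) h i | coeff-+P f g i | coeff-+P f (g +P h) i | coeff-+P g h i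
  = ℚₚ.+-assoc (coeff f i) (coeff g i) (coeff h i)

+P-comm : ∀ f g → f +P g ≈ g +P f
+P-comm f g .coeff-≡ i rewrite coeff-+P f g i | coeff-+P g f i = ℚₚ.+-comm (coeff f i) (coeff g i)

+P-identityʳ : ∀ f → f +P [] ≈ f
+P-identityʳ []      = ≈-refl
+P-identityʳ (a ∷ f) = ≈-refl

-P-inverseʳ : ∀ f → f +P (-P f) ≈ []
-P-inverseʳ f .coeff-≡ i rewrite coeff-+P f (-P f) i | coeff--P f i = ℚₚ.+-inverseʳ (coeff f i)

*P-zeroʳ : ∀ f → f *P [] ≈ []
*P-zeroʳ []      = ≈-refl
*P-zeroʳ (a ∷ f) = ≈-trans (∷-cong refl (*P-zeroʳ f)) 0∷[]≈[]

*P-identityˡ : ∀ f → oneP *P f ≈ f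
*P-identityˡ f .coeff-≡ i rewrite coeff-∷*P 1ℚ [] f i | 0∷[]≈[] .coeff-≡ i =
  trans (ℚₚ.+-identityʳ _) (ℚₚ.*-identityˡ (coeff f i))

module _ where
  open +-*-Solver

  *P-distribʳ : ∀ f g h → (f +P g) *P h ≈ f *P h +P g *P h
  *P-distribʳ []      g       h = ≈-refl
  *P-distribʳ (a ∷ f) []      h = ≈-sym (+P-identityʳ _)
  *P-distribʳ (a ∷ f) (b ∷ g) h .coeff-≡ zero
    rewrite coeff-+P ((a ∷ f) *P h) ((b ∷ g) *P h) zero
          | coeff-∷*P (a +ℚ b) (f +P g) h zero | coeff-∷*P a f h zero | coeff-∷*P b g h zero
    = solve 3 (λ a b x → (a :+ b) :* x :+ con 0ℚ := (a :* x :+ con 0ℚ) :+ (b :* x :+ con 0ℚ))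
        refl a b (coeff h zero)
  *P-distribʳ (a ∷ f) (b ∷ g) h .coeff-≡ (suc i)
    rewrite coeff-+P ((a ∷ f) *P h) ((b ∷ g) *P h) (suc i)
          | coeff-∷*P (a +ℚ b) (f +P g) h (suc i) | coeff-∷*P a f h (suc i) | coeff-∷*P b g h (suc i)
          | *P-distribʳ f g h .coeff-≡ i | coeff-+P (f *P h) (g *P h) i
    = solve 5 (λ a b x u v → (a :+ b) :* x :+ (u :+ v) := (a :* x :+ u) :+ (b :* x :+ v))
        refl a b (coeff h (suc i)) (coeff (f *P h) i) (coeff (g *P h) i)

  scaleP-*P : ∀ a g h → scaleP a g *P h ≈ scaleP a (g *P h)
  scaleP-*P a []      h = ≈-refl
  scaleP-*P a (b ∷ g) h .coeff-≡ zero
    rewrite coeff-∷*P (a *ℚ b) (scaleP a g) h zero | coeff-scaleP a ((b ∷ g) *P h) zero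
          | coeff-∷*P b g h zero
    = solve 3 (λ a b x → a :* b :* x :+ con 0ℚ := a :* (b :* x :+ con 0ℚ)) refl a b (coeff h zero)
  scaleP-*P a (b ∷ g) h .coeff-≡ (suc i)
    rewrite coeff-∷*P (a *ℚ b) (scaleP a g) h (suc i) | coeff-scaleP a ((b ∷ g) *P h) (suc i)
          | coeff-∷*P b g h (suc i) | scaleP-*P a g h .coeff-≡ i | coeff-scaleP a (g *P h) i
    = solve 4 (λ a b x u → a :* b :* x :+ a :* u := a :* (b :* x :+ u))
        refl a b (coeff h (suc i)) (coeff (g *P h) i)

  *P-∷ʳ : ∀ f b g → f *P (b ∷ g) ≈ scaleP b f +P (0ℚ ∷ f *P g)
  *P-∷ʳ []      b g = ≈-sym 0∷[]≈[]
  *P-∷ʳ (a ∷ f) b g .coeff-≡ zero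
    rewrite coeff-∷*P a f (b ∷ g) zero | coeff-+P (scaleP b (a ∷ f)) (0ℚ ∷ (a ∷ f) *P g) zero
    = solve 2 (λ a b → a :* b :+ con 0ℚ := b :* a :+ con 0ℚ) refl a b
  *P-∷ʳ (a ∷ f) b g .coeff-≡ (suc i) = begin
    coeff (scaleP a g +P f *P (b ∷ g)) i
      ≡⟨ coeff-+P (scaleP a g) (f *P (b ∷ g)) i ⟩
    coeff (scaleP a g) i +ℚ coeff (f *P (b ∷ g)) i
      ≡⟨ cong (coeff (scaleP a g) i +ℚ_) (*P-∷ʳ f b g .coeff-≡ i) ⟩
    coeff (scaleP a g) i +ℚ coeff (scaleP b f +P (0ℚ ∷ f *P g)) i
      ≡⟨ cong₂ _+ℚ_ (coeff-scaleP a g i) (coeff-+P (scaleP b f) (0ℚ ∷ f *P g) i) ⟩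
    a *ℚ coeff g i +ℚ (coeff (scaleP b f) i +ℚ s)
      ≡⟨ cong (λ t → a *ℚ coeff g i +ℚ (t +ℚ s)) (coeff-scaleP b f i) ⟩
    a *ℚ coeff g i +ℚ (b *ℚ coeff f i +ℚ s)
      ≡⟨ solve 3 (λ x y s → x :+ (y :+ s) := y :+ (x :+ s)) refl (a *ℚ coeff g i) (b *ℚ coeff f i) s ⟩
    b *ℚ coeff f i +ℚ (a *ℚ coeff g i +ℚ s)
      ≡⟨ cong₂ _+ℚ_ (coeff-scaleP b f i) (coeff-∷*P a f g i) ⟨
    coeff (scaleP b f) i +ℚ coeff ((a ∷ f) *P g) i
      ≡⟨ coeff-+P (scaleP b f) ((a ∷ f) *P g) i ⟨
    coeff (scaleP b f +P (a ∷ f) *P g) i ∎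
    where
    open ≡-Reasoning
    s = coeff (0ℚ ∷ f *P g) i

0∷-*P : ∀ f h → (0ℚ ∷ f) *P h ≈ 0ℚ ∷ f *P h
0∷-*P f h .coeff-≡ i rewrite coeff-∷*P 0ℚ f h i =
  trans (cong (_+ℚ coeff (0ℚ ∷ f *P h) i) (ℚₚ.*-zeroˡ (coeff h i))) (ℚₚ.+-identityˡ _)

*P-assoc : ∀ f g h → (f *P g) *P h ≈ f *P (g *P h)
*P-assoc []      g h = ≈-refl
*P-assoc (a ∷ f) g h =
  ≈-trans (*P-distribʳ (scaleP a g) (0ℚ ∷ f *P g) h)
    (+P-cong (scaleP-*P a g h) (≈-trans (0∷-*P (f *P g) h) (∷-cong refl (*P-assoc f g h))))

*P-comm : ∀ f g → f *P g ≈ g *P f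
*P-comm []      g = ≈-sym (*P-zeroʳ g)
*P-comm (a ∷ f) g = ≈-trans (+P-cong (≈-refl {scaleP a g}) (∷-cong refl (*P-comm f g))) (≈-sym (*P-∷ʳ g a f))

*P-cong : ∀ {f f′ g g′} → f ≈ f′ → g ≈ g′ → f *P g ≈ f′ *P g′
*P-cong {f} {f′} {g} {g′} e d =
  ≈-trans (*P-comm f g) (≈-trans (*P-congˡ g e) (≈-trans (*P-comm g f′) (*P-congˡ f′ d)))

Poly-commutativeRing : CommutativeRing _ _
Poly-commutativeRing = record
  { Carrier = Poly ; _≈_ = _≈_ ; _+_ = _+P_ ; _*_ = _*P_ ; -_ = -P_ ; 0# = [] ; 1# = oneP
  ; isCommutativeRing = record
    { isRing = record
      { +-isAbelianGroup = record
        { isGroup = record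
          { isMonoid = record
            { isSemigroup = record
              { isMagma = record
                { isEquivalence = record { refl = ≈-refl ; sym = ≈-sym ; trans = ≈-trans }
                ; ∙-cong = +P-cong }
              ; assoc = +P-assoc }
            ; identity = (λ f → ≈-refl) , +P-identityʳ }
          ; inverse = (λ f → ≈-trans (+P-comm (-P f) f) (-P-inverseʳ f)) , -P-inverseʳ
          ; ⁻¹-cong = -P-cong }
        ; comm = +P-comm }
      ; *-cong = *P-cong
      ; *-assoc = *P-assoc
      ; *-identity = *P-identityˡ , (λ f → ≈-trans (*P-comm f oneP) (*P-identityˡ f))
      ; distrib = (λ f g h → ≈-trans (*P-comm f (g +P h))
                               (≈-trans (*P-distribʳ g h f) (+P-cong (*P-comm g f) (*P-comm h f))))
                , (λ h f g → *P-distribʳ f g h) }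
    ; *-comm = *P-comm } }

module ≈-Reasoning = Relation.Binary.Reasoning.Setoid (CommutativeRing.setoid Poly-commutativeRing)

[]≈? : ∀ f → Maybe ([] ≈ f)
[]≈? []      = just ≈-refl
[]≈? (a ∷ f) with 0ℚ ℚₚ.≟ a | []≈? f
... | yes 0≡a | just []≈f = just (≈-trans (≈-sym 0∷[]≈[]) (∷-cong 0≡a []≈f))
... | _       | _         = nothing

Poly-ring : AlmostCommutativeRing _ _
Poly-ring = fromCommutativeRing Poly-commutativeRing []≈?

^P-cong : ∀ {f g} k → f ≈ g → f ^P k ≈ g ^P k
^P-cong zero    e = ≈-refl
^P-cong (suc k) e = *P-cong e (^P-cong k e)

^P-+ : ∀ f a b → f ^P (a + b) ≈ f ^P a *P f ^P b
^P-+ f zero    b = ≈-sym (*P-identityˡ _)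
^P-+ f (suc a) b = ≈-trans (*P-congˡ f (^P-+ f a b)) (≈-sym (*P-assoc f (f ^P a) (f ^P b)))

^P-distrib-*P : ∀ f g k → (f *P g) ^P k ≈ f ^P k *P g ^P k
^P-distrib-*P f g zero    = ≈-sym (*P-identityˡ oneP)
^P-distrib-*P f g (suc k) =
  ≈-trans (*P-congˡ (f *P g) (^P-distrib-*P f g k)) (interchange f g (f ^P k) (g ^P k))
  where
  interchange : ∀ a b c d → (a *P b) *P (c *P d) ≈ (a *P c) *P (b *P d)
  interchange = solve-∀ Poly-ring

natP-+ : ∀ a b → natP (a + b) ≈ natP a +P natP b
natP-+ zero    b = ≈-refl
natP-+ (suc a) b = ≈-trans (+P-cong (≈-refl {oneP}) (natP-+ a b)) (≈-sym (+P-assoc oneP (natP a) (natP b)))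

[a+b]q≈[a]q+qᵃ*[b]q : ∀ a b → [ a + b ]q ≈ [ a ]q +P qP ^P a *P [ b ]q
[a+b]q≈[a]q+qᵃ*[b]q zero    b = ≈-sym (*P-identityˡ _)
[a+b]q≈[a]q+qᵃ*[b]q (suc a) b = ≈-sym (begin
  (1ℚ ∷ [ a ]q) +P (qP *P qP ^P a) *P [ b ]q  ≈⟨ +P-cong (≈-refl {1ℚ ∷ [ a ]q}) (*P-assoc qP (qP ^P a) [ b ]q) ⟩
  (1ℚ ∷ [ a ]q) +P qP *P (qP ^P a *P [ b ]q) ≈⟨ +P-cong (≈-refl {1ℚ ∷ [ a ]q}) (0∷-*P oneP _) ⟩
  (1ℚ ∷ [ a ]q) +P (0ℚ ∷ oneP *P (qP ^P a *P [ b ]q))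
    ≈⟨ ∷-cong (ℚₚ.+-identityʳ 1ℚ) (+P-cong (≈-refl {[ a ]q}) (*P-identityˡ _)) ⟩
  1ℚ ∷ ([ a ]q +P qP ^P a *P [ b ]q)         ≈⟨ ∷-cong refl ([a+b]q≈[a]q+qᵃ*[b]q a b) ⟨
  1ℚ ∷ [ a + b ]q ∎)
  where open ≈-Reasoning

pascal : ∀ k n → (k + suc n) C suc n ≡ (k + n) C n + (k + suc n ∸ 1) C suc n
pascal k n rewrite ℕₚ.+-suc k n = sym (nCk+nC[k+1]≡[n+1]C[k+1] (k + n) n)

negBinomial : Poly → ℕ → ℕ → Poly
negBinomial x k n = ΣP n (λ l → natP ((k + l ∸ 1) C l) *P (x ^P l))

negBinomialDefect : Poly → ℕ → ℕ → Poly
negBinomialDefect x zero    n = []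
negBinomialDefect x (suc k) n = negBinomialDefect x k n +P natP ((k + n) C n) *P (oneP -P x) ^P k

negBinomial-0 : ∀ x n → negBinomial x 0 (suc n) ≈ oneP
negBinomial-0 x zero    = ≈-trans (+P-identityʳ _) (*P-identityˡ oneP)
negBinomial-0 x (suc n) rewrite k>n⇒nCk≡0 (ℕₚ.n<1+n n) = ≈-trans (+P-identityʳ _) (negBinomial-0 x n)

negBinomial-suc : ∀ x k n →
  negBinomial x (suc k) (suc n) ≈ negBinomial x k (suc n) +P x *P negBinomial x (suc k) n
negBinomial-suc x k zero =
  ≈-sym (+P-cong (≈-refl {negBinomial x k 1}) (*P-zeroʳ x))
negBinomial-suc x k (suc n) = begin
  negBinomial x (suc k) (suc n) +P natP ((k + suc n) C suc n) *P x ^P suc n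
    ≈⟨ +P-cong (negBinomial-suc x k n) (*P-cong (≡⇒≈ (cong natP (pascal k n))) ≈-refl) ⟩
  (negBinomial x k (suc n) +P x *P negBinomial x (suc k) n) +P (natP (c₁ + c₂)) *P x ^P suc n
    ≈⟨ +P-cong ≈-refl (*P-cong (natP-+ c₁ c₂) ≈-refl) ⟩
  (negBinomial x k (suc n) +P x *P negBinomial x (suc k) n) +P (natP c₁ +P natP c₂) *P (x *P x ^P n)
    ≈⟨ regroup (negBinomial x k (suc n)) (negBinomial x (suc k) n) x (natP c₁) (natP c₂) (x ^P n) ⟩
  (negBinomial x k (suc n) +P natP c₂ *P x ^P suc n) +P x *P (negBinomial x (suc k) n +P natP c₁ *P x ^P n) ∎
  where
  open ≈-Reasoning
  c₁ = (k + n) C n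
  c₂ = (k + suc n ∸ 1) C suc n
  regroup : ∀ A B x c₁ c₂ y →
    (A +P x *P B) +P (c₁ +P c₂) *P (x *P y) ≈ (A +P c₂ *P (x *P y)) +P x *P (B +P c₁ *P y)
  regroup = solve-∀ Poly-ring

negBinomial-inverse : ∀ x k n →
  (oneP -P x) ^P k *P negBinomial x k (suc n) ≈ oneP -P x ^P suc n *P negBinomialDefect x k n
negBinomial-inverse x zero n = begin
  oneP *P negBinomial x 0 (suc n)    ≈⟨ *P-identityˡ _ ⟩
  negBinomial x 0 (suc n)            ≈⟨ negBinomial-0 x n ⟩
  oneP                               ≈⟨ +P-cong (≈-refl {oneP}) (-P-cong (*P-zeroʳ (x ^P suc n))) ⟨
  oneP -P x ^P suc n *P []           ∎
  where open ≈-Reasoning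
negBinomial-inverse x (suc k) n = begin
  ((oneP -P x) *P A) *P (B +P c *P x ^P n)
    ≈⟨ expand x A (B +P c *P x ^P n) ⟩
  A *P negBinomial x (suc k) (suc n) -P x *P (A *P (B +P c *P x ^P n))
    ≈⟨ +P-cong (*P-congˡ A (negBinomial-suc x k n)) ≈-refl ⟩
  A *P (negBinomial x k (suc n) +P x *P B) -P x *P (A *P (B +P c *P x ^P n))
    ≈⟨ cancel x A (negBinomial x k (suc n)) B c (x ^P n) ⟩
  A *P negBinomial x k (suc n) -P (x *P x ^P n) *P (c *P A)
    ≈⟨ +P-cong (negBinomial-inverse x k n) ≈-refl ⟩
  (oneP -P x ^P suc n *P negBinomialDefect x k n) -P x ^P suc n *P (c *P A)
    ≈⟨ collect oneP (x ^P suc n) (negBinomialDefect x k n) (c *P A) ⟩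
  oneP -P x ^P suc n *P negBinomialDefect x (suc k) n ∎
  where
  open ≈-Reasoning
  A = (oneP -P x) ^P k
  B = negBinomial x (suc k) n
  c = natP ((k + n) C n)
  expand : ∀ x A Z → ((oneP -P x) *P A) *P Z ≈ A *P Z -P x *P (A *P Z)
  expand = solve-∀ Poly-ring
  cancel : ∀ x A S B c y →
    A *P (S +P x *P B) -P x *P (A *P (B +P c *P y)) ≈ A *P S -P (x *P y) *P (c *P A)
  cancel = solve-∀ Poly-ring
  collect : ∀ o y T D → (o -P y *P T) -P y *P D ≈ o -P y *P (T +P D)
  collect = solve-∀ Poly-ring

module _ {p : ℕ} (p-prime : Prime p) where

  IsZpPoly-+P : ∀ {f g} → IsZpPoly p f → IsZpPoly p g → IsZpPoly p (f +P g)
  IsZpPoly-+P                 []         zg         = zg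
  IsZpPoly-+P                 (za ∷ zf) []         = za ∷ zf
  IsZpPoly-+P {a ∷ f} {b ∷ g} (za ∷ zf) (zb ∷ zg) = InZ-+ p-prime {a} {b} za zb ∷ IsZpPoly-+P zf zg

  IsZpPoly--P : ∀ {f} → IsZpPoly p f → IsZpPoly p (-P f)
  IsZpPoly--P zf = map⁺ (All-map (λ {x} → InZ-neg p-prime {x}) zf)

  IsZpPoly-*P : ∀ {f g} → IsZpPoly p f → IsZpPoly p g → IsZpPoly p (f *P g)
  IsZpPoly-*P         []         zg = []
  IsZpPoly-*P {a ∷ f} (za ∷ zf) zg =
    IsZpPoly-+P (map⁺ (All-map (λ {x} → InZ-* p-prime {a} {x} za) zg)) (InZ-0 p-prime ∷ IsZpPoly-*P zf zg)

  IsZpPoly-oneP : IsZpPoly p oneP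
  IsZpPoly-oneP = InZ-1 p-prime ∷ []

  IsZpPoly-qP : IsZpPoly p qP
  IsZpPoly-qP = InZ-0 p-prime ∷ InZ-1 p-prime ∷ []

  IsZpPoly-[]q : ∀ j → IsZpPoly p [ j ]q
  IsZpPoly-[]q j = replicate⁺ j (InZ-1 p-prime)

  IsZpPoly-natP : ∀ j → IsZpPoly p (natP j)
  IsZpPoly-natP zero    = []
  IsZpPoly-natP (suc j) = IsZpPoly-+P IsZpPoly-oneP (IsZpPoly-natP j)

  IsZpPoly-^P : ∀ {f} k → IsZpPoly p f → IsZpPoly p (f ^P k)
  IsZpPoly-^P zero    zf = IsZpPoly-oneP
  IsZpPoly-^P (suc k) zf = IsZpPoly-*P zf (IsZpPoly-^P k zf)

  IsZpPoly-negBinomial : ∀ {x} k n → IsZpPoly p x → IsZpPoly p (negBinomial x k n)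
  IsZpPoly-negBinomial k zero    zx = []
  IsZpPoly-negBinomial k (suc n) zx =
    IsZpPoly-+P (IsZpPoly-negBinomial k n zx) (IsZpPoly-*P (IsZpPoly-natP ((k + n ∸ 1) C n)) (IsZpPoly-^P n zx))

  IsZpPoly-negBinomialDefect : ∀ {x} k n → IsZpPoly p x → IsZpPoly p (negBinomialDefect x k n)
  IsZpPoly-negBinomialDefect zero    n zx = []
  IsZpPoly-negBinomialDefect (suc k) n zx =
    IsZpPoly-+P (IsZpPoly-negBinomialDefect k n zx)
      (IsZpPoly-*P (IsZpPoly-natP ((k + n) C n)) (IsZpPoly-^P k (IsZpPoly-+P IsZpPoly-oneP (IsZpPoly--P zx))))

-- Cong p n, repackaged as a record with _≈_ for the same reason as _≈_ itself.
record Congruent (p n : ℕ) (f g : Poly) : Set where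
  constructor congruent
  field
    quotient    : Poly
    quotient-Zp : IsZpPoly p quotient
    difference≈ : f -P g ≈ [ p ]q ^P n *P quotient

Cong⇒Congruent : ∀ {p n f g} → Cong p n f g → Congruent p n f g
Cong⇒Congruent (h , zh , e) = congruent h zh (coeffwise e)

Congruent⇒Cong : ∀ {p n f g} → Congruent p n f g → Cong p n f g
Congruent⇒Cong (congruent h zh e) = h , zh , e .coeff-≡

module _ {p : ℕ} (p-prime : Prime p) (n : ℕ) where

  ≈⇒Congruent : ∀ {f g} → f ≈ g → Congruent p n f g
  ≈⇒Congruent {f} {g} f≈g = congruent [] [] (begin
    f -P g                 ≈⟨ +P-cong f≈g ≈-refl ⟩
    g -P g                 ≈⟨ -P-inverseʳ g ⟩
    []                     ≈⟨ *P-zeroʳ ([ p ]q ^P n) ⟨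
    [ p ]q ^P n *P []      ∎)
    where open ≈-Reasoning

  Congruent-sym : ∀ {f g} → Congruent p n f g → Congruent p n g f
  Congruent-sym {f} {g} (congruent h zh e) = congruent (-P h) (IsZpPoly--P p-prime zh) (begin
    g -P f                 ≈⟨ swap f g ⟩
    -P (f -P g)            ≈⟨ -P-cong e ⟩
    -P ([ p ]q ^P n *P h)  ≈⟨ neg-*ʳ ([ p ]q ^P n) h ⟩
    [ p ]q ^P n *P -P h    ∎)
    where
    open ≈-Reasoning
    swap : ∀ f g → g -P f ≈ -P (f -P g)
    swap = solve-∀ Poly-ring
    neg-*ʳ : ∀ a b → -P (a *P b) ≈ a *P -P b
    neg-*ʳ = solve-∀ Poly-ring

  Congruent-trans : ∀ {f g h} → Congruent p n f g → Congruent p n g h → Congruent p n f h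
  Congruent-trans {f} {g} {h} (congruent d₁ zd₁ e₁) (congruent d₂ zd₂ e₂) =
    congruent (d₁ +P d₂) (IsZpPoly-+P p-prime zd₁ zd₂) (begin
      f -P h                                         ≈⟨ telescope f g h ⟩
      (f -P g) +P (g -P h)                           ≈⟨ +P-cong e₁ e₂ ⟩
      [ p ]q ^P n *P d₁ +P [ p ]q ^P n *P d₂         ≈⟨ factor ([ p ]q ^P n) d₁ d₂ ⟩
      [ p ]q ^P n *P (d₁ +P d₂)                      ∎)
    where
    open ≈-Reasoning
    telescope : ∀ f g h → f -P h ≈ (f -P g) +P (g -P h)
    telescope = solve-∀ Poly-ring
    factor : ∀ a b c → a *P b +P a *P c ≈ a *P (b +P c)
    factor = solve-∀ Poly-ring

  Congruent-setoid : Setoid _ _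
  Congruent-setoid = record
    { Carrier = Poly
    ; _≈_ = Congruent p n
    ; isEquivalence = record { refl = ≈⇒Congruent ≈-refl ; sym = Congruent-sym ; trans = Congruent-trans } }

  Congruent-+P : ∀ {f₁ f₂ g₁ g₂} → Congruent p n f₁ g₁ → Congruent p n f₂ g₂ →
                 Congruent p n (f₁ +P f₂) (g₁ +P g₂)
  Congruent-+P {f₁} {f₂} {g₁} {g₂} (congruent d₁ zd₁ e₁) (congruent d₂ zd₂ e₂) =
    congruent (d₁ +P d₂) (IsZpPoly-+P p-prime zd₁ zd₂) (begin
      (f₁ +P f₂) -P (g₁ +P g₂)                       ≈⟨ regroup f₁ f₂ g₁ g₂ ⟩
      (f₁ -P g₁) +P (f₂ -P g₂)                       ≈⟨ +P-cong e₁ e₂ ⟩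
      [ p ]q ^P n *P d₁ +P [ p ]q ^P n *P d₂         ≈⟨ factor ([ p ]q ^P n) d₁ d₂ ⟩
      [ p ]q ^P n *P (d₁ +P d₂)                      ∎)
    where
    open ≈-Reasoning
    regroup : ∀ f₁ f₂ g₁ g₂ → (f₁ +P f₂) -P (g₁ +P g₂) ≈ (f₁ -P g₁) +P (f₂ -P g₂)
    regroup = solve-∀ Poly-ring
    factor : ∀ a b c → a *P b +P a *P c ≈ a *P (b +P c)
    factor = solve-∀ Poly-ring

  Congruent-*P : ∀ {f₁ f₂ g₁ g₂} → IsZpPoly p f₂ → IsZpPoly p g₁ →
                 Congruent p n f₁ g₁ → Congruent p n f₂ g₂ → Congruent p n (f₁ *P f₂) (g₁ *P g₂)
  Congruent-*P {f₁} {f₂} {g₁} {g₂} zf₂ zg₁ (congruent d₁ zd₁ e₁) (congruent d₂ zd₂ e₂) =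
    congruent (d₁ *P f₂ +P g₁ *P d₂)
      (IsZpPoly-+P p-prime (IsZpPoly-*P p-prime zd₁ zf₂) (IsZpPoly-*P p-prime zg₁ zd₂)) (begin
        f₁ *P f₂ -P g₁ *P g₂                                  ≈⟨ split f₁ f₂ g₁ g₂ ⟩
        (f₁ -P g₁) *P f₂ +P g₁ *P (f₂ -P g₂)                  ≈⟨ +P-cong (*P-cong e₁ ≈-refl)
                                                                          (*P-congˡ g₁ e₂) ⟩
        ([ p ]q ^P n *P d₁) *P f₂ +P g₁ *P ([ p ]q ^P n *P d₂) ≈⟨ factor ([ p ]q ^P n) d₁ f₂ g₁ d₂ ⟩
        [ p ]q ^P n *P (d₁ *P f₂ +P g₁ *P d₂)                  ∎)
    where
    open ≈-Reasoning
    split : ∀ f₁ f₂ g₁ g₂ → f₁ *P f₂ -P g₁ *P g₂ ≈ (f₁ -P g₁) *P f₂ +P g₁ *P (f₂ -P g₂)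
    split = solve-∀ Poly-ring
    factor : ∀ a d₁ f₂ g₁ d₂ → (a *P d₁) *P f₂ +P g₁ *P (a *P d₂) ≈ a *P (d₁ *P f₂ +P g₁ *P d₂)
    factor = solve-∀ Poly-ring

  Congruent-^P : ∀ {f g} k → IsZpPoly p f → IsZpPoly p g → Congruent p n f g → Congruent p n (f ^P k) (g ^P k)
  Congruent-^P zero    zf zg f≡g = ≈⇒Congruent ≈-refl
  Congruent-^P (suc k) zf zg f≡g = Congruent-*P (IsZpPoly-^P p-prime k zf) zg f≡g (Congruent-^P k zf zg f≡g)

negBinomial-inverse-mod : ∀ {p x w} → Prime p → ∀ k n → 1 ≤ n → IsZpPoly p x → IsZpPoly p w →
  x ≈ [ p ]q *P w → Congruent p n ((oneP -P x) ^P k *P negBinomial x k n) oneP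
negBinomial-inverse-mod {p} {x} {w} p-prime k (suc n) _ zx zw x≈[p]w =
  congruent (-P (w ^P suc n *P D)) zq (begin
    (oneP -P x) ^P k *P negBinomial x k (suc n) -P oneP
      ≈⟨ +P-cong (negBinomial-inverse x k n) ≈-refl ⟩
    (oneP -P x ^P suc n *P D) -P oneP
      ≈⟨ cancel oneP (x ^P suc n) D ⟩
    -P (x ^P suc n *P D)
      ≈⟨ -P-cong (*P-cong (≈-trans (^P-cong (suc n) x≈[p]w) (^P-distrib-*P [ p ]q w (suc n))) ≈-refl) ⟩
    -P (([ p ]q ^P suc n *P w ^P suc n) *P D)
      ≈⟨ reassoc ([ p ]q ^P suc n) (w ^P suc n) D ⟩
    [ p ]q ^P suc n *P -P (w ^P suc n *P D) ∎)
  where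
  open ≈-Reasoning
  D = negBinomialDefect x k n
  zq : IsZpPoly p (-P (w ^P suc n *P D))
  zq = IsZpPoly--P p-prime
         (IsZpPoly-*P p-prime (IsZpPoly-^P p-prime (suc n) zw) (IsZpPoly-negBinomialDefect p-prime k n zx))
  cancel : ∀ o y t → (o -P y *P t) -P o ≈ -P (y *P t)
  cancel = solve-∀ Poly-ring
  reassoc : ∀ a b c → -P ((a *P b) *P c) ≈ a *P -P (b *P c)
  reassoc = solve-∀ Poly-ring

[a]q≈[a+b]q-qᵃ*[b]q : ∀ a b → [ a ]q ≈ [ a + b ]q -P qP ^P a *P [ b ]q
[a]q≈[a+b]q-qᵃ*[b]q a b = begin
  [ a ]q                                              ≈⟨ add-sub [ a ]q (qP ^P a *P [ b ]q) ⟩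
  ([ a ]q +P qP ^P a *P [ b ]q) -P qP ^P a *P [ b ]q ≈⟨ +P-cong ([a+b]q≈[a]q+qᵃ*[b]q a b) ≈-refl ⟨
  [ a + b ]q -P qP ^P a *P [ b ]q                     ∎
  where
  open ≈-Reasoning
  add-sub : ∀ f g → f ≈ (f +P g) -P g
  add-sub = solve-∀ Poly-ring

[p∸m]q*-aqᵐb≡1-a[p]qᵐb : ∀ {p m n a b} → Prime p → m ≤ p → IsZpPoly p a →
  Congruent p n (b *P [ m ]q) oneP → Congruent p n (a *P qP ^P p) oneP →
  Congruent p n ([ p ∸ m ]q *P -P (a *P qP ^P m *P b)) (oneP -P a *P [ p ]q *P qP ^P m *P b)
[p∸m]q*-aqᵐb≡1-a[p]qᵐb {p} {m} {n} {a} {b} p-prime m≤p za b[m]≡1 aqᵖ≡1 = begin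
  [ p ∸ m ]q *P -P (a *P qᵐ *P b)
    ≈⟨ ≈⇒Congruent p-prime n (*P-cong [p∸m]≈[p]-qᵖ⁻ᵐ[m] ≈-refl) ⟩
  ([ p ]q -P qᵖ⁻ᵐ *P [ m ]q) *P -P (a *P qᵐ *P b)
    ≈⟨ ≈⇒Congruent p-prime n (expand a b [ p ]q [ m ]q qᵐ qᵖ⁻ᵐ) ⟩
  (b *P [ m ]q) *P (a *P (qᵐ *P qᵖ⁻ᵐ)) -P x
    ≈⟨ ≈⇒Congruent p-prime n (+P-cong (*P-congˡ (b *P [ m ]q) (*P-congˡ a qᵖ≈qᵐqᵖ⁻ᵐ)) ≈-refl) ⟨
  (b *P [ m ]q) *P (a *P qP ^P p) -P x
    ≈⟨ Congruent-+P p-prime n (Congruent-*P p-prime n zaqᵖ (IsZpPoly-oneP p-prime) b[m]≡1 aqᵖ≡1)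
                              (≈⇒Congruent p-prime n ≈-refl) ⟩
  oneP *P oneP -P x
    ≈⟨ ≈⇒Congruent p-prime n (+P-cong (*P-identityˡ oneP) (≈-refl { -P x})) ⟩
  oneP -P x ∎
  where
  open import Relation.Binary.Reasoning.Setoid (Congruent-setoid p-prime n)
  qᵐ   = qP ^P m
  qᵖ⁻ᵐ = qP ^P (p ∸ m)
  x    = a *P [ p ]q *P qᵐ *P b
  zaqᵖ : IsZpPoly p (a *P qP ^P p)
  zaqᵖ = IsZpPoly-*P p-prime za (IsZpPoly-^P p-prime p (IsZpPoly-qP p-prime))
  [p∸m]≈[p]-qᵖ⁻ᵐ[m] : [ p ∸ m ]q ≈ [ p ]q -P qᵖ⁻ᵐ *P [ m ]q
  [p∸m]≈[p]-qᵖ⁻ᵐ[m] = ≈-trans ([a]q≈[a+b]q-qᵃ*[b]q (p ∸ m) m)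
                         (+P-cong (≡⇒≈ (cong [_]q (ℕₚ.m∸n+n≡m m≤p))) ≈-refl)
  qᵖ≈qᵐqᵖ⁻ᵐ : qP ^P p ≈ qᵐ *P qᵖ⁻ᵐ
  qᵖ≈qᵐqᵖ⁻ᵐ = ≈-trans (≡⇒≈ (cong (qP ^P_) (sym (ℕₚ.m+[n∸m]≡n m≤p)))) (^P-+ qP m (p ∸ m))
  expand : ∀ a b P M qᵐ s →
    (P -P s *P M) *P -P (a *P qᵐ *P b) ≈ (b *P M) *P (a *P (qᵐ *P s)) -P a *P P *P qᵐ *P b
  expand = solve-∀ Poly-ring

lemmaB1 : (p m k n : ℕ) → Prime p → 1 ≤ m → m < p → 1 ≤ k → 1 ≤ n →
    (invm invqp : Poly) → IsZpPoly p invm → IsZpPoly p invqp →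
    Cong p n (invm *P [ m ]q) oneP →
    Cong p n (invqp *P (qP ^P p)) oneP →
    Cong p n
      (([ p ∸ m ]q ^P k) *P
        (((-P (invqp *P (qP ^P m) *P invm)) ^P k) *P
          ΣP n (λ l → natP ((k + l ∸ 1) C l) *P
                      ((invqp *P [ p ]q *P (qP ^P m) *P invm) ^P l))))
      oneP
lemmaB1 p m k n p-prime _ m<p _ 1≤n invm invqp zinvm zinvqp invm-inv invqp-inv = Congruent⇒Cong (begin
  [ p ∸ m ]q ^P k *P (u ^P k *P S)  ≈⟨ ≈⇒Congruent p-prime n regroup ⟩
  ([ p ∸ m ]q *P u) ^P k *P S       ≈⟨ Congruent-*P p-prime n zS (IsZpPoly-^P p-prime k z1-x)
                                         (Congruent-^P p-prime n k z[p∸m]u z1-x [p∸m]u≡1-x)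
                                         (≈⇒Congruent p-prime n ≈-refl) ⟩
  (oneP -P x) ^P k *P S             ≈⟨ negBinomial-inverse-mod p-prime k n 1≤n zx zw x≈[p]w ⟩
  oneP                              ∎)
  where
  open import Relation.Binary.Reasoning.Setoid (Congruent-setoid p-prime n)
  w = invqp *P qP ^P m *P invm
  u = -P w
  x = invqp *P [ p ]q *P qP ^P m *P invm
  S = negBinomial x k n
  zw : IsZpPoly p w
  zw = IsZpPoly-*P p-prime (IsZpPoly-*P p-prime zinvqp (IsZpPoly-^P p-prime m (IsZpPoly-qP p-prime))) zinvm
  zx : IsZpPoly p x
  zx = IsZpPoly-*P p-prime (IsZpPoly-*P p-prime (IsZpPoly-*P p-prime zinvqp (IsZpPoly-[]q p-prime p))
         (IsZpPoly-^P p-prime m (IsZpPoly-qP p-prime))) zinvm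
  zS : IsZpPoly p S
  zS = IsZpPoly-negBinomial p-prime k n zx
  z1-x : IsZpPoly p (oneP -P x)
  z1-x = IsZpPoly-+P p-prime (IsZpPoly-oneP p-prime) (IsZpPoly--P p-prime zx)
  z[p∸m]u : IsZpPoly p ([ p ∸ m ]q *P u)
  z[p∸m]u = IsZpPoly-*P p-prime (IsZpPoly-[]q p-prime (p ∸ m)) (IsZpPoly--P p-prime zw)
  [p∸m]u≡1-x : Congruent p n ([ p ∸ m ]q *P u) (oneP -P x)
  [p∸m]u≡1-x = [p∸m]q*-aqᵐb≡1-a[p]qᵐb p-prime (ℕₚ.<⇒≤ m<p) zinvqp
                 (Cong⇒Congruent invm-inv) (Cong⇒Congruent invqp-inv)
  regroup : [ p ∸ m ]q ^P k *P (u ^P k *P S) ≈ ([ p ∸ m ]q *P u) ^P k *P S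
  regroup = ≈-trans (≈-sym (*P-assoc ([ p ∸ m ]q ^P k) (u ^P k) S))
                    (*P-cong (≈-sym (^P-distrib-*P [ p ∸ m ]q u k)) ≈-refl)
  x≈[p]w : x ≈ [ p ]q *P w
  x≈[p]w = pull-out invqp [ p ]q (qP ^P m) invm
    where
    pull-out : ∀ a P qᵐ b → a *P P *P qᵐ *P b ≈ P *P (a *P qᵐ *P b)
    pull-out = solve-∀ Poly-ring
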